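{- For all integers $k,\ell,r$ with $\ell\geq 0$, $1\leq r\leq k$ and $\ell>k-r$, the polynomial \[C_{k-r}(q)\,C_{\ell+r}(q)-q^{r(\ell-k+r)}\,C_k(q)\,C_\ell(q)\] has nonnegative coefficients.
   Context: For an integer $n\geq 0$, a lattice permutation with $n$ 1s and $n$ 2s is a word $\pi=\pi_1\cdots\pi_{2n}$ containing exactly $n$ letters $1$ and $n$ letters $2$ such that every initial segment $\pi_1\cdots\pi_j$ contains no more 2s than 1s. The inversion number ${\rm inv}\,\pi$ is the number of pairs $i<j$ with $\pi_i=2$ and $\pi_j=1$. The $q$-Catalan number is $C_n(q)=\sum_\pi q^{{\rm inv}\,\pi}$, the sum over all lattice permutations $\pi$ with $n$ 1s and $n$ 2s (so $C_0(q)=1$). Equivalently, $C_0(q)=1$ and $C_{n+1}(q)=\sum_{k=0}^n q^{(k+1)(n-k)}C_k(q)C_{n-k}(q)$. -}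

module Defs where

open import Data.Nat using (ℕ; zero; suc; _∸_) renaming (_*_ to _*ℕ_; _+_ to _+ℕ_)
open import Data.Integer using (ℤ; +_; _+_; _*_; -_; _≤_)
open import Data.List using (List; []; _∷_; map; upTo; foldr; replicate; _++_; length)
open import Data.List.Relation.Unary.All using (All)

-- Polynomials in q with integer coefficients, as coefficient lists
-- (constant term first; trailing zeros allowed).
Poly : Set
Poly = List ℤ

infixl 6 _⊕_ _⊖_
infixl 7 _⊛_ _·_

_⊕_ : Poly → Poly → Poly
[] ⊕ q = q
(a ∷ p) ⊕ [] = a ∷ p
(a ∷ p) ⊕ (b ∷ q) = (a + b) ∷ (p ⊕ q)

neg : Poly → Poly
neg = map (-_)

_⊖_ : Poly → Poly → Poly
p ⊖ q = p ⊕ neg q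

_·_ : ℤ → Poly → Poly
c · p = map (c *_) p

_⊛_ : Poly → Poly → Poly
[] ⊛ q = []
(a ∷ p) ⊛ q = (a · q) ⊕ (+ 0 ∷ (p ⊛ q))

qpow* : ℕ → Poly → Poly
qpow* m p = replicate m (+ 0) ++ p

one : Poly
one = + 1 ∷ []

-- nth element with default 0 polynomial
nth : List Poly → ℕ → Poly
nth [] _ = []
nth (x ∷ xs) zero = x
nth (x ∷ xs) (suc i) = nth xs i

sumP : List Poly → Poly
sumP = foldr _⊕_ []

nextCat : ℕ → List Poly → Poly
nextCat n cs = sumP (map (λ k → qpow* (suc k *ℕ (n ∸ k)) (nth cs k ⊛ nth cs (n ∸ k))) (upTo (suc n)))

catList : ℕ → List Poly
catList zero = one ∷ []
catList (suc n) = catList n ++ (nextCat n (catList n) ∷ [])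

qCatalan : ℕ → Poly
qCatalan n = nth (catList n) n

NonNegCoeffs : Poly → Set
NonNegCoeffs p = All (λ c → + 0 ≤ c) p

{-# OPTIONS --safe #-}
-- Reading a letter 1 as an east step and a letter 2 as a north step, C_n(q) is the generating
-- function of lattice paths from (0,0) to (n,n) in the region y ≤ x in which an east step at
-- height y has weight q^y.  A path from (s,s) is a path from the origin translated by (s,s), each
-- east step gaining a factor q^s.  With s = ℓ + r − k the polynomial of the theorem, multiplied by
-- q^(s(k−r)), is the Lindström–Gessel–Viennot determinant
--   P((0,0) → (ℓ+r,ℓ+r)) P((s,s) → (ℓ,ℓ)) − P((0,0) → (ℓ,ℓ)) P((s,s) → (ℓ+r,ℓ+r)),
-- and since every path from (s,s) to (ℓ+r,ℓ+r) meets every path from (0,0) to (ℓ,ℓ) it counts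
-- non-intersecting pairs.  Instead of the path-switching involution we expand such determinants
-- along the last steps of their two end points, which writes each one as a combination with
-- nonnegative coefficients of determinants of earlier end points.  The path sums satisfy the
-- recursion defining C_n(q) by the first-return decomposition.
module Submission where

open import Defs
open import Data.Nat using (ℕ; zero; suc; _+_; _*_; _∸_; _≤_; _<_; _≟_; _≤?_; z≤n; s≤s; z<s; s<s)
import Data.Nat.Properties as ℕₚ
open import Algebra.Properties.CommutativeSemigroup ℕₚ.+-commutativeSemigroup using (xy∙z≈xz∙y)
open import Data.Nat.Tactic.RingSolver renaming (solve-∀ to ℕ-solve-∀)
open import Data.Integer as ℤ using (ℤ; +_; -_)
import Data.Integer.Properties as ℤₚ
open import Data.List using ([]; _∷_; _++_; length; applyUpTo; map; upTo)
import Data.List.Properties as Listₚ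
open import Data.List.Relation.Unary.All using ([]; _∷_)
open import Data.Maybe using (nothing)
open import Data.Empty using (⊥-elim)
open import Data.Product using (_×_; _,_; proj₁; proj₂; uncurry)
open import Data.Sum using (inj₁; inj₂)
open import Function using (_∘_; id)
open import Relation.Nullary using (yes; no)
open import Relation.Binary.PropositionalEquality
open import Relation.Binary.Structures using (IsEquivalence)
open import Relation.Binary.Bundles using (Setoid)
import Relation.Binary.Reasoning.Setoid
open import Algebra.Bundles using (CommutativeRing)
open import Tactic.RingSolver.Core.AlmostCommutativeRing using (AlmostCommutativeRing; fromCommutativeRing)
open import Tactic.RingSolver using (solve-∀)

-- Coefficientwise equality and the ring of polynomials

coeff : Poly → ℕ → ℤ
coeff []      _       = + 0
coeff (a ∷ p) zero    = a
coeff (a ∷ p) (suc i) = coeff p i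

infix 4 _≈_

record _≈_ (p q : Poly) : Set where
  constructor coeffwise
  field coeff-≡ : ∀ i → coeff p i ≡ coeff q i
open _≈_ public

≈-refl : ∀ {p} → p ≈ p
≈-refl = coeffwise λ _ → refl

≈-reflexive : ∀ {p q} → p ≡ q → p ≈ q
≈-reflexive refl = ≈-refl

≈-sym : ∀ {p q} → p ≈ q → q ≈ p
≈-sym e = coeffwise λ i → sym (coeff-≡ e i)

≈-trans : ∀ {p q r} → p ≈ q → q ≈ r → p ≈ r
≈-trans e f = coeffwise λ i → trans (coeff-≡ e i) (coeff-≡ f i)

≈-isEquivalence : IsEquivalence _≈_
≈-isEquivalence = record { refl = ≈-refl ; sym = ≈-sym ; trans = ≈-trans }

≈-setoid : Setoid _ _
≈-setoid = record { isEquivalence = ≈-isEquivalence }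

module ≈-Reasoning = Relation.Binary.Reasoning.Setoid ≈-setoid

∷-cong : ∀ {a b p q} → a ≡ b → p ≈ q → a ∷ p ≈ b ∷ q
∷-cong a≡b p≈q = coeffwise λ { zero → a≡b ; (suc i) → coeff-≡ p≈q i }

coeff-⊕ : ∀ p q i → coeff (p ⊕ q) i ≡ coeff p i ℤ.+ coeff q i
coeff-⊕ []      q       i       = sym (ℤₚ.+-identityˡ _)
coeff-⊕ (a ∷ p) []      i       = sym (ℤₚ.+-identityʳ _)
coeff-⊕ (a ∷ p) (b ∷ q) zero    = refl
coeff-⊕ (a ∷ p) (b ∷ q) (suc i) = coeff-⊕ p q i

coeff-neg : ∀ p i → coeff (neg p) i ≡ - coeff p i
coeff-neg []      i       = refl
coeff-neg (a ∷ p) zero    = refl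
coeff-neg (a ∷ p) (suc i) = coeff-neg p i

coeff-· : ∀ c p i → coeff (c · p) i ≡ c ℤ.* coeff p i
coeff-· c []      i       = sym (ℤₚ.*-zeroʳ c)
coeff-· c (a ∷ p) zero    = refl
coeff-· c (a ∷ p) (suc i) = coeff-· c p i

⊕-cong : ∀ {p p' q q'} → p ≈ p' → q ≈ q' → p ⊕ q ≈ p' ⊕ q'
⊕-cong {p} {p'} {q} {q'} e f = coeffwise λ i →
  trans (coeff-⊕ p q i) (trans (cong₂ ℤ._+_ (coeff-≡ e i) (coeff-≡ f i)) (sym (coeff-⊕ p' q' i)))

neg-cong : ∀ {p p'} → p ≈ p' → neg p ≈ neg p'
neg-cong {p} {p'} e = coeffwise λ i →
  trans (coeff-neg p i) (trans (cong -_ (coeff-≡ e i)) (sym (coeff-neg p' i)))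

·-congʳ : ∀ c {p p'} → p ≈ p' → c · p ≈ c · p'
·-congʳ c {p} {p'} e = coeffwise λ i →
  trans (coeff-· c p i) (trans (cong (c ℤ.*_) (coeff-≡ e i)) (sym (coeff-· c p' i)))

⊕-comm : ∀ p q → p ⊕ q ≈ q ⊕ p
⊕-comm p q = coeffwise λ i →
  trans (coeff-⊕ p q i) (trans (ℤₚ.+-comm (coeff p i) _) (sym (coeff-⊕ q p i)))

⊕-assoc : ∀ p q r → (p ⊕ q) ⊕ r ≈ p ⊕ (q ⊕ r)
⊕-assoc p q r = coeffwise assoc
  where
  assoc : ∀ i → coeff ((p ⊕ q) ⊕ r) i ≡ coeff (p ⊕ (q ⊕ r)) i
  assoc i rewrite coeff-⊕ (p ⊕ q) r i | coeff-⊕ p q i | coeff-⊕ p (q ⊕ r) i | coeff-⊕ q r i =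
    ℤₚ.+-assoc (coeff p i) _ _

⊕-identityˡ : ∀ p → [] ⊕ p ≈ p
⊕-identityˡ p = ≈-refl

⊕-identityʳ : ∀ p → p ⊕ [] ≈ p
⊕-identityʳ p = coeffwise λ i → trans (coeff-⊕ p [] i) (ℤₚ.+-identityʳ _)

⊕-vanishˡ : ∀ {p q} → p ≈ [] → p ⊕ q ≈ q
⊕-vanishˡ p≈[] = ⊕-cong p≈[] ≈-refl

⊕-inverseˡ : ∀ p → neg p ⊕ p ≈ []
⊕-inverseˡ p = coeffwise λ i →
  trans (coeff-⊕ (neg p) p i) (trans (cong (ℤ._+ coeff p i) (coeff-neg p i)) (ℤₚ.+-inverseˡ (coeff p i)))

⊕-inverseʳ : ∀ p → p ⊕ neg p ≈ []
⊕-inverseʳ p = ≈-trans (⊕-comm p (neg p)) (⊕-inverseˡ p)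

⊕-interchange : ∀ p q r s → (p ⊕ q) ⊕ (r ⊕ s) ≈ (p ⊕ r) ⊕ (q ⊕ s)
⊕-interchange p q r s = coeffwise swap
  where
  open import Algebra.Properties.CommutativeSemigroup ℤₚ.+-commutativeSemigroup using (interchange)
  swap : ∀ i → coeff ((p ⊕ q) ⊕ (r ⊕ s)) i ≡ coeff ((p ⊕ r) ⊕ (q ⊕ s)) i
  swap i rewrite coeff-⊕ (p ⊕ q) (r ⊕ s) i | coeff-⊕ (p ⊕ r) (q ⊕ s) i
               | coeff-⊕ p q i | coeff-⊕ r s i | coeff-⊕ p r i | coeff-⊕ q s i =
    interchange (coeff p i) _ _ _

·-distribˡ : ∀ c p q → c · (p ⊕ q) ≈ c · p ⊕ c · q
·-distribˡ c p q = coeffwise distrib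
  where
  distrib : ∀ i → coeff (c · (p ⊕ q)) i ≡ coeff (c · p ⊕ c · q) i
  distrib i rewrite coeff-· c (p ⊕ q) i | coeff-⊕ p q i | coeff-⊕ (c · p) (c · q) i
                  | coeff-· c p i | coeff-· c q i = ℤₚ.*-distribˡ-+ c _ _

·-assoc : ∀ c d p → c · (d · p) ≈ (c ℤ.* d) · p
·-assoc c d p = coeffwise assoc
  where
  assoc : ∀ i → coeff (c · (d · p)) i ≡ coeff ((c ℤ.* d) · p) i
  assoc i rewrite coeff-· c (d · p) i | coeff-· d p i | coeff-· (c ℤ.* d) p i =
    sym (ℤₚ.*-assoc c d _)

·-identity : ∀ p → + 1 · p ≈ p
·-identity p = coeffwise λ i → trans (coeff-· (+ 1) p i) (ℤₚ.*-identityˡ _)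

·-zero : ∀ p → + 0 · p ≈ []
·-zero p = coeffwise (coeff-· (+ 0) p)

·-shift : ∀ c p → c · (+ 0 ∷ p) ≈ + 0 ∷ c · p
·-shift c p = ∷-cong (ℤₚ.*-zeroʳ c) ≈-refl

shift-zero : + 0 ∷ [] ≈ []
shift-zero = coeffwise λ { zero → refl ; (suc i) → refl }

⊛-congʳ : ∀ p {q q'} → q ≈ q' → p ⊛ q ≈ p ⊛ q'
⊛-congʳ []      e = ≈-refl
⊛-congʳ (a ∷ p) e = ⊕-cong (·-congʳ a e) (∷-cong refl (⊛-congʳ p e))

⊛-zeroʳ : ∀ p → p ⊛ [] ≈ []
⊛-zeroʳ []      = ≈-refl
⊛-zeroʳ (a ∷ p) = ≈-trans (∷-cong refl (⊛-zeroʳ p)) shift-zero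

⊛-vanishʳ : ∀ p {q} → q ≈ [] → p ⊛ q ≈ []
⊛-vanishʳ p e = ≈-trans (⊛-congʳ p e) (⊛-zeroʳ p)

⊛-consʳ : ∀ p b q → p ⊛ (b ∷ q) ≈ b · p ⊕ (+ 0 ∷ p ⊛ q)
⊛-consʳ []      b q = ≈-sym shift-zero
⊛-consʳ (a ∷ p) b q = ∷-cong (cong (ℤ._+ + 0) (ℤₚ.*-comm a b)) (begin
  a · q ⊕ p ⊛ (b ∷ q)              ≈⟨ ⊕-cong (≈-refl {a · q}) (⊛-consʳ p b q) ⟩
  a · q ⊕ (b · p ⊕ (+ 0 ∷ p ⊛ q))  ≈⟨ ⊕-assoc (a · q) _ _ ⟨
  (a · q ⊕ b · p) ⊕ (+ 0 ∷ p ⊛ q)  ≈⟨ ⊕-cong (⊕-comm (a · q) (b · p)) ≈-refl ⟩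
  (b · p ⊕ a · q) ⊕ (+ 0 ∷ p ⊛ q)  ≈⟨ ⊕-assoc (b · p) _ _ ⟩
  b · p ⊕ (a · q ⊕ (+ 0 ∷ p ⊛ q))  ∎)
  where open ≈-Reasoning

⊛-comm : ∀ p q → p ⊛ q ≈ q ⊛ p
⊛-comm []      q = ≈-sym (⊛-zeroʳ q)
⊛-comm (a ∷ p) q =
  ≈-trans (⊕-cong (≈-refl {a · q}) (∷-cong refl (⊛-comm p q))) (≈-sym (⊛-consʳ q a p))

⊛-congˡ : ∀ {p p'} q → p ≈ p' → p ⊛ q ≈ p' ⊛ q
⊛-congˡ {p} {p'} q e = ≈-trans (⊛-comm p q) (≈-trans (⊛-congʳ q e) (⊛-comm q p'))

⊛-cong : ∀ {p p' q q'} → p ≈ p' → q ≈ q' → p ⊛ q ≈ p' ⊛ q'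
⊛-cong {p} {p'} {q} e f = ≈-trans (⊛-congˡ q e) (⊛-congʳ p' f)

⊛-distribˡ : ∀ p q r → p ⊛ (q ⊕ r) ≈ p ⊛ q ⊕ p ⊛ r
⊛-distribˡ []      q r = ≈-refl
⊛-distribˡ (a ∷ p) q r =
  ≈-trans (⊕-cong (·-distribˡ a q r) (∷-cong refl (⊛-distribˡ p q r)))
          (⊕-interchange (a · q) (a · r) (+ 0 ∷ p ⊛ q) (+ 0 ∷ p ⊛ r))

⊛-distribʳ : ∀ r p q → (p ⊕ q) ⊛ r ≈ p ⊛ r ⊕ q ⊛ r
⊛-distribʳ r p q = ≈-trans (⊛-comm (p ⊕ q) r)
  (≈-trans (⊛-distribˡ r p q) (⊕-cong (⊛-comm r p) (⊛-comm r q)))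

·-⊛ : ∀ c p q → (c · p) ⊛ q ≈ c · (p ⊛ q)
·-⊛ c []      q = ≈-refl
·-⊛ c (a ∷ p) q = begin
  (c ℤ.* a) · q ⊕ (+ 0 ∷ (c · p) ⊛ q)
    ≈⟨ ⊕-cong (≈-sym (·-assoc c a q)) (∷-cong refl (·-⊛ c p q)) ⟩
  c · (a · q) ⊕ (+ 0 ∷ c · (p ⊛ q))
    ≈⟨ ⊕-cong (≈-refl {c · (a · q)}) (≈-sym (·-shift c (p ⊛ q))) ⟩
  c · (a · q) ⊕ c · (+ 0 ∷ p ⊛ q)
    ≈⟨ ·-distribˡ c (a · q) _ ⟨
  c · (a · q ⊕ (+ 0 ∷ p ⊛ q))  ∎
  where open ≈-Reasoning

shift-⊛ : ∀ p q → (+ 0 ∷ p) ⊛ q ≈ + 0 ∷ p ⊛ q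
shift-⊛ p q = ⊕-cong (·-zero q) ≈-refl

⊛-assoc : ∀ p q r → (p ⊛ q) ⊛ r ≈ p ⊛ (q ⊛ r)
⊛-assoc []      q r = ≈-refl
⊛-assoc (a ∷ p) q r =
  ≈-trans (⊛-distribʳ r (a · q) (+ 0 ∷ p ⊛ q))
          (⊕-cong (·-⊛ a q r) (≈-trans (shift-⊛ (p ⊛ q) r) (∷-cong refl (⊛-assoc p q r))))

⊛-identityˡ : ∀ p → one ⊛ p ≈ p
⊛-identityˡ p = ≈-trans (⊕-cong (·-identity p) shift-zero) (⊕-identityʳ p)

⊛-identityʳ : ∀ p → p ⊛ one ≈ p
⊛-identityʳ p = ≈-trans (⊛-comm p one) (⊛-identityˡ p)

polyRing : CommutativeRing _ _
polyRing = record
  { Carrier = Poly ; _≈_ = _≈_ ; _+_ = _⊕_ ; _*_ = _⊛_ ; -_ = neg ; 0# = [] ; 1# = one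
  ; isCommutativeRing = record
    { isRing = record
      { +-isAbelianGroup = record
        { isGroup = record
          { isMonoid = record
            { isSemigroup = record
              { isMagma = record { isEquivalence = ≈-isEquivalence ; ∙-cong = ⊕-cong }
              ; assoc = ⊕-assoc }
            ; identity = ⊕-identityˡ , ⊕-identityʳ }
          ; inverse = ⊕-inverseˡ , ⊕-inverseʳ
          ; ⁻¹-cong = neg-cong }
        ; comm = ⊕-comm }
      ; *-cong = ⊛-cong
      ; *-assoc = ⊛-assoc
      ; *-identity = ⊛-identityˡ , ⊛-identityʳ
      ; distrib = ⊛-distribˡ , ⊛-distribʳ }
    ; *-comm = ⊛-comm } }

polyACR : AlmostCommutativeRing _ _
polyACR = fromCommutativeRing polyRing (λ _ → nothing)

record Nonneg (p : Poly) : Set where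
  constructor nonneg
  field coeff-nonneg : ∀ i → + 0 ℤ.≤ coeff p i
open Nonneg public

private
  0≤+ : ∀ {n} → + 0 ℤ.≤ + n
  0≤+ = ℤ.+≤+ z≤n

  0≤-* : ∀ {x y} → + 0 ℤ.≤ x → + 0 ℤ.≤ y → + 0 ℤ.≤ x ℤ.* y
  0≤-* (ℤ.+≤+ {n = m} _) (ℤ.+≤+ {n = n} _) = subst (+ 0 ℤ.≤_) (ℤₚ.pos-* m n) 0≤+

Nonneg-resp : ∀ {p q} → p ≈ q → Nonneg p → Nonneg q
Nonneg-resp e h = nonneg λ i → subst (+ 0 ℤ.≤_) (coeff-≡ e i) (coeff-nonneg h i)

Nonneg-[] : Nonneg []
Nonneg-[] = nonneg λ _ → 0≤+

≈[]⇒Nonneg : ∀ {p} → p ≈ [] → Nonneg p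
≈[]⇒Nonneg e = Nonneg-resp (≈-sym e) Nonneg-[]

Nonneg-one : Nonneg one
Nonneg-one = nonneg λ { zero → 0≤+ ; (suc i) → 0≤+ }

Nonneg-tail : ∀ {a p} → Nonneg (a ∷ p) → Nonneg p
Nonneg-tail h = nonneg λ i → coeff-nonneg h (suc i)

Nonneg-shift : ∀ {p} → Nonneg p → Nonneg (+ 0 ∷ p)
Nonneg-shift h = nonneg λ { zero → 0≤+ ; (suc i) → coeff-nonneg h i }

Nonneg-⊕ : ∀ {p q} → Nonneg p → Nonneg q → Nonneg (p ⊕ q)
Nonneg-⊕ {p} {q} h k = nonneg λ i →
  subst (+ 0 ℤ.≤_) (sym (coeff-⊕ p q i)) (ℤₚ.+-mono-≤ (coeff-nonneg h i) (coeff-nonneg k i))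

Nonneg-· : ∀ {c p} → + 0 ℤ.≤ c → Nonneg p → Nonneg (c · p)
Nonneg-· {c} {p} 0≤c h = nonneg λ i →
  subst (+ 0 ℤ.≤_) (sym (coeff-· c p i)) (0≤-* 0≤c (coeff-nonneg h i))

Nonneg-⊛ : ∀ {p q} → Nonneg p → Nonneg q → Nonneg (p ⊛ q)
Nonneg-⊛ {[]}    h k = Nonneg-[]
Nonneg-⊛ {a ∷ p} h k = Nonneg-⊕ (Nonneg-· (coeff-nonneg h 0) k) (Nonneg-shift (Nonneg-⊛ (Nonneg-tail h) k))

Nonneg⇒NonNegCoeffs : ∀ {p} → Nonneg p → NonNegCoeffs p
Nonneg⇒NonNegCoeffs {[]}    h = []
Nonneg⇒NonNegCoeffs {a ∷ p} h = coeff-nonneg h 0 ∷ Nonneg⇒NonNegCoeffs (Nonneg-tail h)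

opaque
  q^_ : ℕ → Poly
  q^ m = qpow* m one

  qpow*≈q^⊛ : ∀ m p → qpow* m p ≈ q^ m ⊛ p
  qpow*≈q^⊛ zero    p = ≈-sym (⊛-identityˡ p)
  qpow*≈q^⊛ (suc m) p = ≈-trans (∷-cong refl (qpow*≈q^⊛ m p)) (≈-sym (shift-⊛ (q^ m) p))

  q^-+ : ∀ a b → q^ (a + b) ≈ q^ a ⊛ q^ b
  q^-+ zero    b = ≈-sym (⊛-identityˡ (q^ b))
  q^-+ (suc a) b = ≈-trans (∷-cong refl (q^-+ a b)) (≈-sym (shift-⊛ (q^ a) (q^ b)))

  Nonneg-q^ : ∀ m → Nonneg (q^ m)
  Nonneg-q^ zero    = Nonneg-one
  Nonneg-q^ (suc m) = Nonneg-shift (Nonneg-q^ m)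

  q^-zero : q^ 0 ≈ one
  q^-zero = ≈-refl

q^-exchange : ∀ a b c d → a + b ≡ c + d → ∀ p → q^ a ⊛ (q^ b ⊛ p) ≈ q^ c ⊛ (q^ d ⊛ p)
q^-exchange a b c d e p = begin
  q^ a ⊛ (q^ b ⊛ p)  ≈⟨ ⊛-assoc (q^ a) (q^ b) p ⟨
  q^ a ⊛ q^ b ⊛ p    ≈⟨ ⊛-congˡ p (q^-+ a b) ⟨
  q^ (a + b) ⊛ p     ≡⟨ cong (λ n → q^ n ⊛ p) e ⟩
  q^ (c + d) ⊛ p     ≈⟨ ⊛-congˡ p (q^-+ c d) ⟩
  q^ c ⊛ q^ d ⊛ p    ≈⟨ ⊛-assoc (q^ c) (q^ d) p ⟩
  q^ c ⊛ (q^ d ⊛ p)  ∎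
  where open ≈-Reasoning

Nonneg-cancel-q^ : ∀ m {p} → Nonneg (q^ m ⊛ p) → Nonneg p
Nonneg-cancel-q^ m {p} h = nonneg λ i → subst (+ 0 ℤ.≤_) (coeff-qpow* m i) (coeff-nonneg h' (m + i))
  where
  h' = Nonneg-resp (≈-sym (qpow*≈q^⊛ m p)) h
  coeff-qpow* : ∀ m i → coeff (qpow* m p) (m + i) ≡ coeff p i
  coeff-qpow* zero    i = refl
  coeff-qpow* (suc m) i = coeff-qpow* m i

opaque
  ∑< : ℕ → (ℕ → Poly) → Poly
  ∑< n f = sumP (applyUpTo f n)

  syntax ∑< n (λ k → e) = ∑[ k < n ] e

  ∑-cong : ∀ n {f g} → (∀ k → k < n → f k ≈ g k) → ∑< n f ≈ ∑< n g
  ∑-cong zero    e = ≈-refl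
  ∑-cong (suc n) e = ⊕-cong (e 0 z<s) (∑-cong n λ k k<n → e (suc k) (s<s k<n))

  ∑-zero : ∀ n f → (∀ k → k < n → f k ≈ []) → ∑< n f ≈ []
  ∑-zero zero    f e = ≈-refl
  ∑-zero (suc n) f e = ⊕-cong (e 0 z<s) (∑-zero n (f ∘ suc) λ k k<n → e (suc k) (s<s k<n))

  ∑-single : ∀ n f j → j < n → (∀ k → k < n → k ≢ j → f k ≈ []) → ∑< n f ≈ f j
  ∑-single (suc n) f zero    _         e =
    ≈-trans (⊕-cong (≈-refl {f 0}) (∑-zero n (f ∘ suc) λ k k<n → e (suc k) (s<s k<n) λ ()))
            (⊕-identityʳ (f 0))
  ∑-single (suc n) f (suc j) (s<s j<n) e =
    ⊕-cong (e 0 z<s λ ())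
           (∑-single n (f ∘ suc) j j<n λ k k<n k≢j → e (suc k) (s<s k<n) (k≢j ∘ ℕₚ.suc-injective))

  ∑-⊕ : ∀ n f g → ∑[ k < n ] (f k ⊕ g k) ≈ ∑< n f ⊕ ∑< n g
  ∑-⊕ zero    f g = ≈-refl
  ∑-⊕ (suc n) f g = ≈-trans (⊕-cong (≈-refl {f 0 ⊕ g 0}) (∑-⊕ n (f ∘ suc) (g ∘ suc)))
                            (⊕-interchange (f 0) (g 0) _ _)

  sumP-map-upTo : ∀ n f → sumP (map f (upTo n)) ≈ ∑< n f
  sumP-map-upTo n f = ≈-reflexive (cong sumP (Listₚ.map-applyUpTo id f n))

  ⊛-∑ : ∀ n c f → c ⊛ ∑< n f ≈ ∑[ k < n ] (c ⊛ f k)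
  ⊛-∑ zero    c f = ⊛-zeroʳ c
  ⊛-∑ (suc n) c f = ≈-trans (⊛-distribˡ c (f 0) _) (⊕-cong (≈-refl {c ⊛ f 0}) (⊛-∑ n c (f ∘ suc)))

-- Weighted lattice paths

opaque
  δ : ℕ → ℕ → ℕ → Poly
  δ s x y with x ≟ s | y ≟ s
  ... | yes _ | yes _ = one
  ... | _     | _     = []

  δ-diag : ∀ s → δ s s s ≈ one
  δ-diag s with s ≟ s
  ... | yes _  = ≈-refl
  ... | no s≢s = ⊥-elim (s≢s refl)

  δ-offˡ : ∀ s x y → x ≢ s → δ s x y ≈ []
  δ-offˡ s x y x≢s with x ≟ s | y ≟ s
  ... | yes x≡s | _ = ⊥-elim (x≢s x≡s)
  ... | no _    | _ = ≈-refl

  δ-offʳ : ∀ s x y → y ≢ s → δ s x y ≈ []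
  δ-offʳ s x y y≢s with x ≟ s | y ≟ s
  ... | _     | yes y≡s = ⊥-elim (y≢s y≡s)
  ... | yes _ | no _    = ≈-refl
  ... | no _  | no _    = ≈-refl

  Nonneg-δ : ∀ s x y → Nonneg (δ s x y)
  Nonneg-δ s x y with x ≟ s | y ≟ s
  ... | yes _ | yes _ = Nonneg-one
  ... | yes _ | no _  = Nonneg-[]
  ... | no _  | _     = Nonneg-[]

δ-offdiag : ∀ s {x y} → x ≢ y → δ s x y ≈ []
δ-offdiag s {x} {y} x≢y with x ≟ s
... | no x≢s  = δ-offˡ s x y x≢s
... | yes x≡s = δ-offʳ s x y λ y≡s → x≢y (trans x≡s (sym y≡s))

δ-level : ∀ s {x y} → s + s < x + y → δ s x y ≈ []
δ-level s {x} {y} 2s<x+y with x ≟ s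
... | no x≢s  = δ-offˡ s x y x≢s
... | yes refl = δ-offʳ s x y λ { refl → ℕₚ.<-irrefl refl 2s<x+y }

-- pathsFrom s (suc x) (suc y) is the sum over lattice paths from (s,s) to (x,y) inside y ≤ x of
-- q^(sum of the heights of the east steps); the index 0 is a border on which everything vanishes.
pathsFrom : ℕ → ℕ → ℕ → Poly
pathsFrom s zero    y       = []
pathsFrom s (suc x) zero    = []
pathsFrom s (suc x) (suc y) with y ≤? x
... | yes _ = δ s x y ⊕ (q^ y ⊛ pathsFrom s x (suc y) ⊕ pathsFrom s (suc x) y)
... | no  _ = []

pathsFrom-step : ∀ s {x y} → y ≤ x →
  pathsFrom s (suc x) (suc y) ≈ δ s x y ⊕ (q^ y ⊛ pathsFrom s x (suc y) ⊕ pathsFrom s (suc x) y)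
pathsFrom-step s {x} {y} y≤x with y ≤? x
... | yes _  = ≈-refl
... | no y≰x = ⊥-elim (y≰x y≤x)

pathsFrom-step-off : ∀ s {x y} → y ≤ x → δ s x y ≈ [] →
  pathsFrom s (suc x) (suc y) ≈ q^ y ⊛ pathsFrom s x (suc y) ⊕ pathsFrom s (suc x) y
pathsFrom-step-off s y≤x δ≈[] = ≈-trans (pathsFrom-step s y≤x) (⊕-vanishˡ δ≈[])

pathsFrom-above : ∀ s {x y} → x ≤ y → pathsFrom s x (suc y) ≈ []
pathsFrom-above s {zero}          _   = ≈-refl
pathsFrom-above s {suc x} {y} x<y with y ≤? x
... | yes y≤x = ⊥-elim (ℕₚ.<⇒≱ x<y y≤x)
... | no _    = ≈-refl

Nonneg-pathsFrom : ∀ s x y → Nonneg (pathsFrom s x y)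
Nonneg-pathsFrom s zero    y       = Nonneg-[]
Nonneg-pathsFrom s (suc x) zero    = Nonneg-[]
Nonneg-pathsFrom s (suc x) (suc y) with y ≤? x
... | yes _ = Nonneg-⊕ (Nonneg-δ s x y)
                       (Nonneg-⊕ (Nonneg-⊛ (Nonneg-q^ y) (Nonneg-pathsFrom s x (suc y)))
                                 (Nonneg-pathsFrom s (suc x) y))
... | no  _ = Nonneg-[]

pathsFrom-below : ∀ s x {y} → y ≤ s → pathsFrom s x y ≈ []
pathsFrom-below s zero    {y}     _   = ≈-refl
pathsFrom-below s (suc x) {zero}  _   = ≈-refl
pathsFrom-below s (suc x) {suc y} y<s with y ≤? x
... | no  _ = ≈-refl
... | yes _ = ≈-trans (⊕-vanishˡ (δ-offʳ s x y (ℕₚ.<⇒≢ y<s)))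
                      (⊕-cong (⊛-vanishʳ (q^ y) (pathsFrom-below s x y<s))
                              (pathsFrom-below s (suc x) (ℕₚ.<⇒≤ y<s)))

δ-translate : ∀ s a b → δ s (a + s) (b + s) ≈ q^ (a * s) ⊛ δ 0 a b
δ-translate s zero    zero    =
  ≈-trans (δ-diag s)
          (≈-sym (≈-trans (⊛-congˡ (δ 0 0 0) q^-zero) (≈-trans (⊛-identityˡ (δ 0 0 0)) (δ-diag 0))))
δ-translate s zero    (suc b) =
  ≈-trans (δ-offʳ s s (suc b + s) (≢-sym (ℕₚ.m≢1+n+m s)))
          (≈-sym (⊛-vanishʳ (q^ 0) (δ-offʳ 0 0 (suc b) λ ())))
δ-translate s (suc a) b       =
  ≈-trans (δ-offˡ s (suc a + s) (b + s) (≢-sym (ℕₚ.m≢1+n+m s)))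
          (≈-sym (⊛-vanishʳ (q^ (suc a * s)) (δ-offˡ 0 (suc a) b λ ())))

pathsFrom-translate : ∀ s a b →
  pathsFrom s (suc (a + s)) (suc (b + s)) ≈ q^ (a * s) ⊛ pathsFrom 0 (suc a) (suc b)
pathsFrom-translate s a b with ℕₚ.≤-<-connex b a
... | inj₂ a<b = ≈-trans (pathsFrom-above s (ℕₚ.+-monoˡ-< s a<b))
                        (≈-sym (⊛-vanishʳ (q^ (a * s)) (pathsFrom-above 0 a<b)))
... | inj₁ b≤a = begin
  pathsFrom s (suc (a + s)) (suc (b + s))
    ≈⟨ pathsFrom-step s (ℕₚ.+-monoˡ-≤ s b≤a) ⟩
  δ s (a + s) (b + s) ⊕ (q^ (b + s) ⊛ pathsFrom s (a + s) (suc (b + s)) ⊕ pathsFrom s (suc (a + s)) (b + s))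
    ≈⟨ ⊕-cong (δ-translate s a b) (⊕-cong (east a b) (north a b)) ⟩
  Q ⊛ δ 0 a b ⊕ (Q ⊛ (q^ b ⊛ pathsFrom 0 a (suc b)) ⊕ Q ⊛ pathsFrom 0 (suc a) b)
    ≈⟨ factor Q _ _ _ ⟩
  Q ⊛ (δ 0 a b ⊕ (q^ b ⊛ pathsFrom 0 a (suc b) ⊕ pathsFrom 0 (suc a) b))
    ≈⟨ ⊛-congʳ Q (≈-sym (pathsFrom-step 0 b≤a)) ⟩
  Q ⊛ pathsFrom 0 (suc a) (suc b)  ∎
  where
  open ≈-Reasoning
  Q = q^ (a * s)
  factor : ∀ c x y z → c ⊛ x ⊕ (c ⊛ y ⊕ c ⊛ z) ≈ c ⊛ (x ⊕ (y ⊕ z))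
  factor = solve-∀ polyACR
  east : ∀ a b →
    q^ (b + s) ⊛ pathsFrom s (a + s) (suc (b + s)) ≈ q^ (a * s) ⊛ (q^ b ⊛ pathsFrom 0 a (suc b))
  east zero     b = ≈-trans (⊛-vanishʳ (q^ (b + s)) (pathsFrom-above s (ℕₚ.m≤n+m s b)))
                            (≈-sym (⊛-vanishʳ (q^ 0) (⊛-zeroʳ (q^ b))))
  east (suc a') b = ≈-trans (⊛-congʳ (q^ (b + s)) (pathsFrom-translate s a' b))
                            (q^-exchange (b + s) (a' * s) (suc a' * s) b
                              (trans (ℕₚ.+-assoc b s _) (ℕₚ.+-comm b _)) _)
  north : ∀ a b → pathsFrom s (suc (a + s)) (b + s) ≈ q^ (a * s) ⊛ pathsFrom 0 (suc a) b
  north a zero     = ≈-trans (pathsFrom-below s (suc (a + s)) ℕₚ.≤-refl) (≈-sym (⊛-zeroʳ (q^ (a * s))))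
  north a (suc b') = pathsFrom-translate s a b'

-- Two-path determinants

module TwoSources (s : ℕ) where

  private
    f g : ℕ → ℕ → Poly
    f = pathsFrom 0
    g = pathsFrom s

  det : ℕ → ℕ → ℕ → ℕ → Poly
  det x₁ y₁ x₂ y₂ = f x₁ y₁ ⊛ g x₂ y₂ ⊖ f x₂ y₂ ⊛ g x₁ y₁

  det-vanishˡ : ∀ x₁ y₁ x₂ y₂ → f x₁ y₁ ≈ [] → g x₁ y₁ ≈ [] → det x₁ y₁ x₂ y₂ ≈ []
  det-vanishˡ x₁ y₁ x₂ y₂ f≈[] g≈[] = ⊕-cong (⊛-congˡ (g x₂ y₂) f≈[]) (neg-cong (⊛-vanishʳ (f x₂ y₂) g≈[]))

  det-vanishʳ : ∀ x₁ y₁ x₂ y₂ → f x₂ y₂ ≈ [] → g x₂ y₂ ≈ [] → det x₁ y₁ x₂ y₂ ≈ []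
  det-vanishʳ x₁ y₁ x₂ y₂ f≈[] g≈[] = ⊕-cong (⊛-vanishʳ (f x₁ y₁) g≈[]) (neg-cong (⊛-congˡ (g x₁ y₁) f≈[]))

  det-self : ∀ x y → det x y x y ≈ []
  det-self x y = ⊕-inverseʳ (f x y ⊛ g x y)

  Nonneg-det-stepˡ : ∀ {x₁ y₁} x₂ y₂ → y₁ ≤ x₁ → δ 0 x₁ y₁ ≈ [] → δ s x₁ y₁ ≈ [] →
    Nonneg (det x₁ (suc y₁) x₂ y₂) → Nonneg (det (suc x₁) y₁ x₂ y₂) →
    Nonneg (det (suc x₁) (suc y₁) x₂ y₂)
  Nonneg-det-stepˡ {x₁} {y₁} x₂ y₂ y₁≤x₁ δ₀≈[] δₛ≈[] h₁ h₂ =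
    Nonneg-resp (≈-sym expand) (Nonneg-⊕ (Nonneg-⊛ (Nonneg-q^ y₁) h₁) h₂)
    where
    identity : ∀ α f' f'' g' g'' f₂ g₂ →
      (α ⊛ f' ⊕ f'') ⊛ g₂ ⊖ f₂ ⊛ (α ⊛ g' ⊕ g'') ≈ α ⊛ (f' ⊛ g₂ ⊖ f₂ ⊛ g') ⊕ (f'' ⊛ g₂ ⊖ f₂ ⊛ g'')
    identity = solve-∀ polyACR
    expand : det (suc x₁) (suc y₁) x₂ y₂ ≈ q^ y₁ ⊛ det x₁ (suc y₁) x₂ y₂ ⊕ det (suc x₁) y₁ x₂ y₂
    expand = ≈-trans (⊕-cong (⊛-congˡ (g x₂ y₂) (pathsFrom-step-off 0 y₁≤x₁ δ₀≈[]))
                             (neg-cong (⊛-congʳ (f x₂ y₂) (pathsFrom-step-off s y₁≤x₁ δₛ≈[]))))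
                     (identity (q^ y₁) (f x₁ (suc y₁)) (f (suc x₁) y₁) (g x₁ (suc y₁)) (g (suc x₁) y₁)
                               (f x₂ y₂) (g x₂ y₂))

  Nonneg-det-stepʳ : ∀ x₁ y₁ {x₂ y₂} → y₂ ≤ x₂ → δ 0 x₂ y₂ ≈ [] →
    Nonneg (det x₁ y₁ x₂ (suc y₂)) → Nonneg (det x₁ y₁ (suc x₂) y₂) →
    Nonneg (det x₁ y₁ (suc x₂) (suc y₂))
  Nonneg-det-stepʳ x₁ y₁ {x₂} {y₂} y₂≤x₂ δ₀≈[] h₁ h₂ = Nonneg-resp (≈-sym expand)
    (Nonneg-⊕ (Nonneg-⊛ (Nonneg-pathsFrom 0 x₁ y₁) (Nonneg-δ s x₂ y₂))
              (Nonneg-⊕ (Nonneg-⊛ (Nonneg-q^ y₂) h₁) h₂))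
    where
    identity : ∀ β d f₁ f' f'' g₁ g' g'' →
      f₁ ⊛ (d ⊕ (β ⊛ g' ⊕ g'')) ⊖ (β ⊛ f' ⊕ f'') ⊛ g₁ ≈
      f₁ ⊛ d ⊕ (β ⊛ (f₁ ⊛ g' ⊖ f' ⊛ g₁) ⊕ (f₁ ⊛ g'' ⊖ f'' ⊛ g₁))
    identity = solve-∀ polyACR
    expand : det x₁ y₁ (suc x₂) (suc y₂) ≈
             f x₁ y₁ ⊛ δ s x₂ y₂ ⊕ (q^ y₂ ⊛ det x₁ y₁ x₂ (suc y₂) ⊕ det x₁ y₁ (suc x₂) y₂)
    expand = ≈-trans (⊕-cong (⊛-congʳ (f x₁ y₁) (pathsFrom-step s y₂≤x₂))
                             (neg-cong (⊛-congˡ (g x₁ y₁) (pathsFrom-step-off 0 y₂≤x₂ δ₀≈[]))))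
                     (identity (q^ y₂) (δ s x₂ y₂) (f x₁ y₁) (f x₂ (suc y₂)) (f (suc x₂) y₂)
                               (g x₁ y₁) (g x₂ (suc y₂)) (g (suc x₂) y₂))

  private
    predecessor-levels : ∀ {a b t} → suc a + suc b ≡ suc t → a + suc b ≡ t × suc a + b ≡ t
    predecessor-levels {a} {b} e = e' , trans (sym (ℕₚ.+-suc a b)) e'
      where e' = ℕₚ.suc-injective e

    vanishesAbove : ∀ {a b} → a < b → f (suc a) (suc b) ≈ [] × g (suc a) (suc b) ≈ []
    vanishesAbove a<b = pathsFrom-above 0 a<b , pathsFrom-above s a<b

  -- For end points on a common antidiagonal with the second one weakly north-west of the first,
  -- every path from (s,s) to the first meets every path from (0,0) to the second.
  Nonneg-det-antidiagonal : ∀ t x₁ y₁ x₂ y₂ → x₁ + y₁ ≡ t → x₂ + y₂ ≡ t → x₂ ≤ x₁ →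
    Nonneg (det x₁ y₁ x₂ y₂)
  Nonneg-det-antidiagonal _ zero     y₁   x₂ y₂ _ _ _ = ≈[]⇒Nonneg (det-vanishˡ zero y₁ x₂ y₂ ≈-refl ≈-refl)
  Nonneg-det-antidiagonal _ (suc a₁) zero x₂ y₂ _ _ _ = ≈[]⇒Nonneg (det-vanishˡ (suc a₁) zero x₂ y₂ ≈-refl ≈-refl)
  Nonneg-det-antidiagonal _ x₁ y₁ zero     y₂   _ _ _ = ≈[]⇒Nonneg (det-vanishʳ x₁ y₁ zero y₂ ≈-refl ≈-refl)
  Nonneg-det-antidiagonal _ x₁ y₁ (suc a₂) zero _ _ _ = ≈[]⇒Nonneg (det-vanishʳ x₁ y₁ (suc a₂) zero ≈-refl ≈-refl)
  Nonneg-det-antidiagonal (suc t) (suc a₁) (suc b₁) (suc a₂) (suc b₂) e₁ e₂ (s≤s a₂≤a₁)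
    with ℕₚ.≤-<-connex b₁ a₁ | ℕₚ.≤-<-connex b₂ a₂ | a₂ ≟ a₁
  ... | inj₂ a₁<b₁ | _          | _        =
    ≈[]⇒Nonneg (uncurry (det-vanishˡ (suc a₁) (suc b₁) (suc a₂) (suc b₂)) (vanishesAbove a₁<b₁))
  ... | inj₁ _     | inj₂ a₂<b₂ | _        =
    ≈[]⇒Nonneg (uncurry (det-vanishʳ (suc a₁) (suc b₁) (suc a₂) (suc b₂)) (vanishesAbove a₂<b₂))
  ... | inj₁ _     | inj₁ _     | yes refl =
    subst (λ y₂ → Nonneg (det (suc a₁) (suc b₁) (suc a₁) y₂)) b₁≡b₂ (≈[]⇒Nonneg (det-self (suc a₁) (suc b₁)))
    where b₁≡b₂ = ℕₚ.+-cancelˡ-≡ (suc a₁) _ _ (trans e₁ (sym e₂))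
  ... | inj₁ b₁≤a₁ | inj₁ b₂≤a₂ | no a₂≢a₁ =
    Nonneg-det-stepˡ (suc a₂) (suc b₂) b₁≤a₁ (δ-offdiag 0 a₁≢b₁) (δ-offdiag s a₁≢b₁)
      (Nonneg-det-stepʳ a₁ (suc b₁) b₂≤a₂ δ₀≈[]
        (Nonneg-det-antidiagonal t a₁ (suc b₁) a₂ (suc b₂) e₁ˣ e₂ˣ (ℕₚ.<⇒≤ a₂<a₁))
        (Nonneg-det-antidiagonal t a₁ (suc b₁) (suc a₂) b₂ e₁ˣ e₂ʸ a₂<a₁))
      (Nonneg-det-stepʳ (suc a₁) b₁ b₂≤a₂ δ₀≈[]
        (Nonneg-det-antidiagonal t (suc a₁) b₁ a₂ (suc b₂) e₁ʸ e₂ˣ (ℕₚ.m≤n⇒m≤1+n a₂≤a₁))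
        (Nonneg-det-antidiagonal t (suc a₁) b₁ (suc a₂) b₂ e₁ʸ e₂ʸ (s≤s a₂≤a₁)))
    where
    a₂<a₁ = ℕₚ.≤∧≢⇒< a₂≤a₁ a₂≢a₁
    e₁ˣ = proj₁ (predecessor-levels e₁) ; e₁ʸ = proj₂ (predecessor-levels e₁)
    e₂ˣ = proj₁ (predecessor-levels e₂) ; e₂ʸ = proj₂ (predecessor-levels e₂)
    same-level : a₂ + b₂ ≡ a₁ + b₁
    same-level = ℕₚ.suc-injective (trans e₂ʸ (sym e₁ʸ))
    a₁≢b₁ : a₁ ≢ b₁
    a₁≢b₁ refl = ℕₚ.<-irrefl same-level (ℕₚ.+-mono-<-≤ a₂<a₁ (ℕₚ.≤-trans b₂≤a₂ a₂≤a₁))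
    δ₀≈[] : δ 0 a₂ b₂ ≈ []
    δ₀≈[] = δ-level 0 (subst (0 <_) (sym same-level)
                         (ℕₚ.<-≤-trans (ℕₚ.≤-<-trans z≤n a₂<a₁) (ℕₚ.m≤m+n a₁ b₁)))

  Nonneg-det-diagonal : ∀ {m} → s ≤ m → ∀ d x y → x + y ≡ (suc m + suc m) + d →
    Nonneg (det x y (suc m) (suc m))
  Nonneg-det-diagonal {m} _ _ zero    y    _ = ≈[]⇒Nonneg (det-vanishˡ zero y (suc m) (suc m) ≈-refl ≈-refl)
  Nonneg-det-diagonal {m} _ _ (suc a) zero _ = ≈[]⇒Nonneg (det-vanishˡ (suc a) zero (suc m) (suc m) ≈-refl ≈-refl)
  Nonneg-det-diagonal {m} s≤m d (suc a) (suc b) e with ℕₚ.≤-<-connex b a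
  ... | inj₂ a<b = ≈[]⇒Nonneg (uncurry (det-vanishˡ (suc a) (suc b) (suc m) (suc m)) (vanishesAbove a<b))
  Nonneg-det-diagonal {m} s≤m zero (suc a) (suc b) e | inj₁ b≤a =
    Nonneg-det-antidiagonal _ (suc a) (suc b) (suc m) (suc m) refl (sym e') (s≤s m≤a)
    where
    e' = trans e (ℕₚ.+-identityʳ _)
    m≤a : m ≤ a
    m≤a = ℕₚ.≮⇒≥ λ a<m → ℕₚ.<-irrefl e' (ℕₚ.+-mono-< (s<s a<m) (s<s (ℕₚ.≤-<-trans b≤a a<m)))
  Nonneg-det-diagonal {m} s≤m (suc d) (suc a) (suc b) e | inj₁ b≤a =
    Nonneg-det-stepˡ (suc m) (suc m) b≤a (δ-level 0 (ℕₚ.≤-<-trans z≤n 2s<a+b)) (δ-level s 2s<a+b)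
      (Nonneg-det-diagonal s≤m d a (suc b) eˣ)
      (Nonneg-det-diagonal s≤m d (suc a) b eʸ)
    where
    eˣ : a + suc b ≡ (suc m + suc m) + d
    eˣ = ℕₚ.suc-injective (trans e (ℕₚ.+-suc _ d))
    eʸ : suc a + b ≡ (suc m + suc m) + d
    eʸ = trans (sym (ℕₚ.+-suc a b)) eˣ
    2s<a+b : s + s < a + b
    2s<a+b = ℕₚ.≤-pred (begin
      suc (suc (s + s))    ≤⟨ s≤s (s≤s (ℕₚ.+-mono-≤ s≤m s≤m)) ⟩
      suc (suc (m + m))    ≡⟨ cong suc (ℕₚ.+-suc m m) ⟨
      suc m + suc m        ≤⟨ ℕₚ.m≤m+n _ d ⟩
      (suc m + suc m) + d  ≡⟨ eʸ ⟨
      suc (a + b)          ∎)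
      where open ℕₚ.≤-Reasoning

-- First return to the diagonal

catalanPath : ℕ → Poly
catalanPath n = pathsFrom 0 (suc n) (suc n)

-- Paths from the origin whose first return to the diagonal is at (k+1,k+1) with k < N.
returning : ℕ → ℕ → ℕ → Poly
returning N x y = ∑[ k < N ] (catalanPath k ⊛ pathsFrom (suc k) x y)

returning-step : ∀ N {x y} → y ≤ x →
  returning N (suc x) (suc y) ≈
  ∑[ k < N ] (catalanPath k ⊛ δ (suc k) x y) ⊕ (q^ y ⊛ returning N x (suc y) ⊕ returning N (suc x) y)
returning-step N {x} {y} y≤x = begin
  returning N (suc x) (suc y)
    ≈⟨ ∑-cong N (λ k _ → ≈-trans (⊛-congʳ (C k) (pathsFrom-step (suc k) y≤x))
                                 (distrib (C k) _ (q^ y) _ _)) ⟩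
  ∑[ k < N ] (D k ⊕ (q^ y ⊛ E k ⊕ F k))
    ≈⟨ ≈-trans (∑-⊕ N D _) (⊕-cong (≈-refl {∑< N D}) (∑-⊕ N (λ k → q^ y ⊛ E k) F)) ⟩
  ∑< N D ⊕ (∑[ k < N ] (q^ y ⊛ E k) ⊕ ∑< N F)
    ≈⟨ ⊕-cong (≈-refl {∑< N D}) (⊕-cong (≈-sym (⊛-∑ N (q^ y) E)) (≈-refl {∑< N F})) ⟩
  ∑< N D ⊕ (q^ y ⊛ ∑< N E ⊕ ∑< N F)  ∎
  where
  open ≈-Reasoning
  C = catalanPath
  D = λ k → C k ⊛ δ (suc k) x y
  E = λ k → C k ⊛ pathsFrom (suc k) x (suc y)
  F = λ k → C k ⊛ pathsFrom (suc k) (suc x) y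
  distrib : ∀ c d α p p' → c ⊛ (d ⊕ (α ⊛ p ⊕ p')) ≈ c ⊛ d ⊕ (α ⊛ (c ⊛ p) ⊕ c ⊛ p')
  distrib = solve-∀ polyACR

returning-above : ∀ N {x y} → x ≤ y → returning N x (suc y) ≈ []
returning-above N x≤y = ∑-zero N _ λ k _ → ⊛-vanishʳ (catalanPath k) (pathsFrom-above (suc k) x≤y)

returning-bottom : ∀ N x → returning N x 1 ≈ []
returning-bottom N x = ∑-zero N _ λ k _ → ⊛-vanishʳ (catalanPath k) (pathsFrom-below (suc k) x (s≤s z≤n))

returning-source-off : ∀ N {x y} → x ≢ y → ∑[ k < N ] (catalanPath k ⊛ δ (suc k) x y) ≈ []
returning-source-off N x≢y = ∑-zero N _ λ k _ → ⊛-vanishʳ (catalanPath k) (δ-offdiag (suc k) x≢y)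

returning-source-diag : ∀ N {j} → j < N →
  ∑[ k < N ] (catalanPath k ⊛ δ (suc k) (suc j) (suc j)) ≈ catalanPath j
returning-source-diag N {j} j<N =
  ≈-trans (∑-single N _ j j<N λ k _ k≢j →
             ⊛-vanishʳ (catalanPath k) (δ-offˡ (suc k) (suc j) (suc j) (k≢j ∘ sym ∘ ℕₚ.suc-injective)))
          (≈-trans (⊛-congʳ (catalanPath j) (δ-diag (suc j))) (⊛-identityʳ (catalanPath j)))

-- The middle term counts the paths that never return to the diagonal: after the first (east)
-- step they are the paths from the origin to (x-1,y), translated by (1,0).
firstReturn : ∀ N x y → y ≤ x → x ≤ N →
  pathsFrom 0 (suc x) (suc y) ≈ δ 0 x y ⊕ (pathsFrom 0 x (suc y) ⊕ returning N (suc x) (suc y))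
firstReturn N zero zero _ _ =
  ≈-trans (pathsFrom-step 0 z≤n)
          (⊕-cong (≈-refl {δ 0 0 0})
                  (≈-trans (≈-trans (⊕-identityʳ _) (⊛-zeroʳ (q^ 0))) (≈-sym (returning-bottom N 1))))
firstReturn N (suc x) zero _ _ =
  ≈-trans (pathsFrom-step 0 z≤n)
          (⊕-cong (≈-refl {δ 0 (suc x) 0})
                  (⊕-cong (≈-trans (⊛-congˡ _ q^-zero) (⊛-identityˡ _))
                          (≈-sym (returning-bottom N (suc (suc x))))))
firstReturn N (suc x') (suc y') (s≤s y'≤x') x≤N with ℕₚ.m≤n⇒m<n∨m≡n y'≤x'
... | inj₁ y<x' = ≈-trans lhs (≈-trans (regroup (q^ y) A Rx B Rsx) (≈-sym rhs))
  where
  x = suc x' ; y = suc y'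
  A = pathsFrom 0 x' (suc y) ; B = pathsFrom 0 x y
  Rx = returning N x (suc y) ; Rsx = returning N (suc x) y
  regroup : ∀ α a r b r' → α ⊛ (a ⊕ r) ⊕ (b ⊕ r') ≈ (α ⊛ a ⊕ b) ⊕ (α ⊛ r ⊕ r')
  regroup = solve-∀ polyACR
  east : pathsFrom 0 x (suc y) ≈ A ⊕ Rx
  east = ≈-trans (firstReturn N x' (suc y') y<x' (ℕₚ.≤-trans (ℕₚ.n≤1+n x') x≤N))
                 (⊕-vanishˡ (δ-offʳ 0 x' y λ ()))
  north : pathsFrom 0 (suc x) y ≈ B ⊕ Rsx
  north = ≈-trans (firstReturn N (suc x') y' (ℕₚ.m≤n⇒m≤1+n y'≤x') x≤N) (⊕-vanishˡ (δ-offˡ 0 x y' λ ()))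
  x≢y : x ≢ y
  x≢y x≡y = ℕₚ.<⇒≢ y<x' (sym (ℕₚ.suc-injective x≡y))
  lhs : pathsFrom 0 (suc x) (suc y) ≈ q^ y ⊛ (A ⊕ Rx) ⊕ (B ⊕ Rsx)
  lhs = ≈-trans (pathsFrom-step-off 0 (s≤s y'≤x') (δ-offˡ 0 x y λ ())) (⊕-cong (⊛-congʳ (q^ y) east) north)
  rhs : δ 0 x y ⊕ (pathsFrom 0 x (suc y) ⊕ returning N (suc x) (suc y)) ≈ (q^ y ⊛ A ⊕ B) ⊕ (q^ y ⊛ Rx ⊕ Rsx)
  rhs = ⊕-cong (δ-offˡ 0 x y λ ())
          (⊕-cong (pathsFrom-step-off 0 y<x' (δ-offʳ 0 x' y λ ()))
                  (≈-trans (returning-step N (s≤s y'≤x')) (⊕-vanishˡ (returning-source-off N x≢y))))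
... | inj₂ refl = ≈-trans lhs (≈-sym rhs)
  where
  x = suc x'
  north : pathsFrom 0 (suc x) x ≈ catalanPath x' ⊕ returning N (suc x) x
  north = ≈-trans (firstReturn N (suc x') x' (ℕₚ.n≤1+n x') x≤N) (⊕-vanishˡ (δ-offˡ 0 x x' λ ()))
  lhs : pathsFrom 0 (suc x) (suc x) ≈ catalanPath x' ⊕ returning N (suc x) x
  lhs = ≈-trans (pathsFrom-step-off 0 ℕₚ.≤-refl (δ-offˡ 0 x x λ ()))
                (⊕-cong (⊛-vanishʳ (q^ x) (pathsFrom-above 0 {x} {x} ℕₚ.≤-refl)) north)
  rhs : δ 0 x x ⊕ (pathsFrom 0 x (suc x) ⊕ returning N (suc x) (suc x)) ≈ catalanPath x' ⊕ returning N (suc x) x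
  rhs = ⊕-cong (δ-offˡ 0 x x λ ())
          (⊕-cong (pathsFrom-above 0 {x} {x} ℕₚ.≤-refl)
                  (≈-trans (returning-step N ℕₚ.≤-refl)
                           (⊕-cong (returning-source-diag N x≤N)
                                   (⊕-vanishˡ (⊛-vanishʳ (q^ x) (returning-above N {x} {x} ℕₚ.≤-refl))))))

catalanPath-zero : catalanPath 0 ≈ one
catalanPath-zero =
  ≈-trans (pathsFrom-step 0 z≤n)
          (≈-trans (⊕-cong (δ-diag 0) (≈-trans (⊕-identityʳ _) (⊛-zeroʳ (q^ 0)))) (⊕-identityʳ one))

catalanPath-suc : ∀ n →
  catalanPath (suc n) ≈ ∑[ k < suc n ] (q^ (suc k * (n ∸ k)) ⊛ (catalanPath k ⊛ catalanPath (n ∸ k)))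
catalanPath-suc n = begin
  catalanPath (suc n)
    ≈⟨ firstReturn (suc n) (suc n) (suc n) ℕₚ.≤-refl ℕₚ.≤-refl ⟩
  δ 0 (suc n) (suc n) ⊕ (pathsFrom 0 (suc n) (suc (suc n)) ⊕ returning (suc n) (suc (suc n)) (suc (suc n)))
    ≈⟨ ⊕-cong (δ-offˡ 0 (suc n) (suc n) λ ()) (⊕-cong (pathsFrom-above 0 {suc n} {suc n} ℕₚ.≤-refl) ≈-refl) ⟩
  returning (suc n) (suc (suc n)) (suc (suc n))
    ≈⟨ ∑-cong (suc n) (λ k k<1+n → firstReturnTerm k (ℕₚ.≤-pred k<1+n)) ⟩
  ∑[ k < suc n ] (q^ (suc k * (n ∸ k)) ⊛ (C k ⊛ C (n ∸ k)))  ∎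
  where
  open ≈-Reasoning
  C = catalanPath
  commute : ∀ c α d → c ⊛ (α ⊛ d) ≈ α ⊛ (c ⊛ d)
  commute = solve-∀ polyACR
  firstReturnTerm : ∀ k → k ≤ n →
    C k ⊛ pathsFrom (suc k) (suc (suc n)) (suc (suc n)) ≈ q^ (suc k * (n ∸ k)) ⊛ (C k ⊛ C (n ∸ k))
  firstReturnTerm k k≤n = begin
    C k ⊛ pathsFrom (suc k) (suc (suc n)) (suc (suc n))
      ≡⟨ cong (λ m → C k ⊛ pathsFrom (suc k) (suc m) (suc m)) 1+n≡ ⟨
    C k ⊛ pathsFrom (suc k) (suc (n ∸ k + suc k)) (suc (n ∸ k + suc k))
      ≈⟨ ⊛-congʳ (C k) (pathsFrom-translate (suc k) (n ∸ k) (n ∸ k)) ⟩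
    C k ⊛ (q^ ((n ∸ k) * suc k) ⊛ C (n ∸ k))
      ≈⟨ commute (C k) (q^ ((n ∸ k) * suc k)) (C (n ∸ k)) ⟩
    q^ ((n ∸ k) * suc k) ⊛ (C k ⊛ C (n ∸ k))
      ≡⟨ cong (λ e → q^ e ⊛ (C k ⊛ C (n ∸ k))) (ℕₚ.*-comm (n ∸ k) (suc k)) ⟩
    q^ (suc k * (n ∸ k)) ⊛ (C k ⊛ C (n ∸ k))  ∎
    where
    1+n≡ : n ∸ k + suc k ≡ suc n
    1+n≡ = trans (ℕₚ.+-suc (n ∸ k) k) (cong suc (ℕₚ.m∸n+n≡m k≤n))

nth-++ˡ : ∀ xs ys {i} → i < length xs → nth (xs ++ ys) i ≡ nth xs i
nth-++ˡ (x ∷ xs) ys {zero}  _         = refl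
nth-++ˡ (x ∷ xs) ys {suc i} (s<s i<n) = nth-++ˡ xs ys i<n

nth-∷ʳ-length : ∀ xs y → nth (xs ++ y ∷ []) (length xs) ≡ y
nth-∷ʳ-length []       y = refl
nth-∷ʳ-length (x ∷ xs) y = nth-∷ʳ-length xs y

length-catList : ∀ n → length (catList n) ≡ suc n
length-catList zero    = refl
length-catList (suc n) =
  trans (Listₚ.length-++ (catList n)) (trans (cong (_+ 1) (length-catList n)) (ℕₚ.+-comm (suc n) 1))

nth-catList : ∀ n {k} → k ≤ n → nth (catList n) k ≈ catalanPath k
nth-catList zero    z≤n = ≈-sym catalanPath-zero
nth-catList (suc n) {k} k≤1+n with ℕₚ.m≤n⇒m<n∨m≡n k≤1+n
... | inj₁ k<1+n = ≈-trans (≈-reflexive (nth-++ˡ (catList n) _ (subst (k <_) (sym (length-catList n)) k<1+n)))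
                           (nth-catList n (ℕₚ.≤-pred k<1+n))
... | inj₂ refl  = begin
  nth (catList (suc n)) (suc n)
    ≡⟨ cong (nth (catList (suc n))) (length-catList n) ⟨
  nth (catList n ++ nextCat n (catList n) ∷ []) (length (catList n))
    ≡⟨ nth-∷ʳ-length (catList n) _ ⟩
  nextCat n (catList n)
    ≈⟨ sumP-map-upTo (suc n) _ ⟩
  ∑[ j < suc n ] qpow* (suc j * (n ∸ j)) (nth (catList n) j ⊛ nth (catList n) (n ∸ j))
    ≈⟨ ∑-cong (suc n) (λ j j<1+n → ≈-trans (qpow*≈q^⊛ (suc j * (n ∸ j)) _)
         (⊛-congʳ (q^ (suc j * (n ∸ j)))
                  (⊛-cong (nth-catList n (ℕₚ.≤-pred j<1+n)) (nth-catList n (ℕₚ.m∸n≤m n j))))) ⟩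
  ∑[ j < suc n ] (q^ (suc j * (n ∸ j)) ⊛ (catalanPath j ⊛ catalanPath (n ∸ j)))
    ≈⟨ catalanPath-suc n ⟨
  catalanPath (suc n)  ∎
  where open ≈-Reasoning

qCatalan≈catalanPath : ∀ n → qCatalan n ≈ catalanPath n
qCatalan≈catalanPath n = nth-catList n ℕₚ.≤-refl

catalanPath-inequality : ∀ a r s →
  Nonneg (catalanPath a ⊛ catalanPath (a + r + s) ⊖ q^ (r * s) ⊛ (catalanPath (a + r) ⊛ catalanPath (a + s)))
catalanPath-inequality a r s =
  Nonneg-cancel-q^ (a * s) (Nonneg-resp det≈ (Nonneg-det-diagonal (ℕₚ.m≤n+m s a) (r + r) x x (level a r s)))
  where
  open TwoSources s
  open ≈-Reasoning
  C = catalanPath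
  x = suc (a + r + s)
  level : ∀ a r s → suc (a + r + s) + suc (a + r + s) ≡ (suc (a + s) + suc (a + s)) + (r + r)
  level = ℕ-solve-∀
  q^-split : q^ ((a + r) * s) ≈ q^ (a * s) ⊛ q^ (r * s)
  q^-split = ≈-trans (≈-reflexive (cong q^_ (ℕₚ.*-distribʳ-+ s a r))) (q^-+ (a * s) (r * s))
  factor : ∀ α β c c' d d' → d ⊛ (α ⊛ c) ⊖ d' ⊛ ((α ⊛ β) ⊛ c') ≈ α ⊛ (c ⊛ d ⊖ β ⊛ (c' ⊛ d'))
  factor = solve-∀ polyACR
  det≈ : det x x (suc (a + s)) (suc (a + s)) ≈
         q^ (a * s) ⊛ (C a ⊛ C (a + r + s) ⊖ q^ (r * s) ⊛ (C (a + r) ⊛ C (a + s)))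
  det≈ = begin
    C (a + r + s) ⊛ pathsFrom s (suc (a + s)) (suc (a + s)) ⊖ C (a + s) ⊛ pathsFrom s x x
      ≈⟨ ⊕-cong (⊛-congʳ (C (a + r + s)) (pathsFrom-translate s a a))
                (neg-cong (⊛-congʳ (C (a + s)) (≈-trans (pathsFrom-translate s (a + r) (a + r))
                                                       (⊛-congˡ (C (a + r)) q^-split)))) ⟩
    C (a + r + s) ⊛ (q^ (a * s) ⊛ C a) ⊖ C (a + s) ⊛ ((q^ (a * s) ⊛ q^ (r * s)) ⊛ C (a + r))
      ≈⟨ factor (q^ (a * s)) (q^ (r * s)) (C a) (C (a + r)) (C (a + r + s)) (C (a + s)) ⟩
    q^ (a * s) ⊛ (C a ⊛ C (a + r + s) ⊖ q^ (r * s) ⊛ (C (a + r) ⊛ C (a + s)))  ∎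

mainTheorem2 : (k ℓ r : ℕ) → 1 ≤ r → r ≤ k → k ∸ r < ℓ →
    NonNegCoeffs ((qCatalan (k ∸ r) ⊛ qCatalan (ℓ + r))
                  ⊖ qpow* (r * (ℓ + r ∸ k)) (qCatalan k ⊛ qCatalan ℓ))
mainTheorem2 k ℓ r _ r≤k k∸r<ℓ with k ∸ r | ℕₚ.m∸n+n≡m r≤k
... | a | refl with ℓ ∸ a | ℕₚ.m+[n∸m]≡n (ℕₚ.<⇒≤ k∸r<ℓ)
... | s | refl rewrite xy∙z≈xz∙y a s r | ℕₚ.m+n∸m≡n (a + r) s =
  Nonneg⇒NonNegCoeffs (Nonneg-resp (≈-sym toPaths) (catalanPath-inequality a r s))
  where
  C = catalanPath
  toPaths : qCatalan a ⊛ qCatalan (a + r + s) ⊖ qpow* (r * s) (qCatalan (a + r) ⊛ qCatalan (a + s))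
          ≈ C a ⊛ C (a + r + s) ⊖ q^ (r * s) ⊛ (C (a + r) ⊛ C (a + s))
  toPaths = ⊕-cong (⊛-cong (qCatalan≈catalanPath a) (qCatalan≈catalanPath (a + r + s)))
                   (neg-cong (≈-trans (qpow*≈q^⊛ (r * s) _)
                                      (⊛-congʳ (q^ (r * s)) (⊛-cong (qCatalan≈catalanPath (a + r))
                                                                    (qCatalan≈catalanPath (a + s))))))
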